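{- Let $\phi$ be an unsatisfiable linear $r$-CNF formula. Then $\mathrm{Space}(\phi)\ge \mathrm{Width}(\phi)-r-1$.
   Context: Linear clauses are disjunctions of linear literals $f=\alpha$ ($f$ a linear form over $\mathbb{F}_2$, $\alpha\in\{0,1\}$); the width of a linear clause is its number of linear literals; a linear $r$-CNF is a conjunction of linear clauses each of width at most $r$. $\mathrm{Res}(\oplus)$ rules: from $A\lor(f=0)$ and $B\lor(f=1)$ derive $A\lor B$; from $C$ derive any linear clause semantically implied by $C$. $\mathrm{Width}(\phi)$ is the minimum, over $\mathrm{Res}(\oplus)$ refutations (derivations of the empty clause from the clauses of $\phi$), of the maximum width of a clause in the refutation. For space, a refutation is a sequence of configurations (sets of linear clauses) $S_1=\emptyset,\dots,S_m$ with $S_m$ containing the empty clause, each obtained from the previous by download (add a clause of $\phi$), erasure (remove a clause), or inference (add a clause derived by the rules from the current clauses); its space is $\max_i|S_i|$, and $\mathrm{Space}(\phi)$ is the minimum space of a refutation of $\phi$. -}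

module Defs where

open import Data.Nat using (ℕ; _⊔_)
open import Data.Bool using (Bool; true; false; _xor_; _∧_)
open import Data.Bool.Properties using () renaming (_≟_ to _≟ᵇ_)
open import Data.Vec using (Vec; foldr; zipWith)
open import Data.Vec.Properties using (≡-dec)
open import Data.Product using (Σ; _×_; _,_; proj₁)
open import Data.Product.Properties using () renaming (≡-dec to ×-≡-dec)
open import Data.Sum using (_⊎_)
open import Data.List using (List; []; _∷_; _++_; length; deduplicate)
open import Data.List.Membership.Propositional using (_∈_)
open import Data.List.Relation.Unary.All using (All)
open import Data.List.Relation.Unary.Any using (Any)
open import Relation.Binary.PropositionalEquality using (_≡_)
open import Relation.Nullary using (¬_)
open import Relation.Binary.Definitions using (DecidableEquality)

-- Variables x₁ … xₙ over 𝔽₂ = Bool (false = 0, true = 1).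
-- A linear form is its coefficient vector; an assignment is a vector of values.
LinForm : ℕ → Set
LinForm n = Vec Bool n

Assignment : ℕ → Set
Assignment n = Vec Bool n

evalForm : ∀ {n} → LinForm n → Assignment n → Bool
evalForm f x = foldr _ _xor_ false (zipWith _∧_ f x)

LinLit : ℕ → Set
LinLit n = LinForm n × Bool

-- linear clause: disjunction of linear literals (a list read as a set)
LinClause : ℕ → Set
LinClause n = List (LinLit n)

LinCNF : ℕ → Set
LinCNF n = List (LinClause n)

SatLit : ∀ {n} → Assignment n → LinLit n → Set
SatLit x (f , α) = evalForm f x ≡ α

SatClause : ∀ {n} → Assignment n → LinClause n → Set
SatClause x C = Any (SatLit x) C

SatCNF : ∀ {n} → Assignment n → LinCNF n → Set
SatCNF x φ = All (SatClause x) φ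

Unsatisfiable : ∀ {n} → LinCNF n → Set
Unsatisfiable {n} φ = (x : Assignment n) → ¬ SatCNF x φ

_≟ℓ_ : ∀ {n} → DecidableEquality (LinLit n)
_≟ℓ_ = ×-≡-dec (≡-dec _≟ᵇ_) _≟ᵇ_

width : ∀ {n} → LinClause n → ℕ
width C = length (deduplicate _≟ℓ_ C)

IsLinearRCNF : ∀ {n} → ℕ → LinCNF n → Set
IsLinearRCNF r φ = All (λ C → width C Data.Nat.≤ r) φ

_≈_ : ∀ {n} → LinClause n → LinClause n → Set
C ≈ D = ∀ ℓ → ((ℓ ∈ C → ℓ ∈ D) × (ℓ ∈ D → ℓ ∈ C))

Resolvent : ∀ {n} → LinClause n → LinClause n → LinClause n → Set
Resolvent {n} C₁ C₂ D =
  Σ (LinForm n) λ f → Σ (LinClause n) λ A → Σ (LinClause n) λ B →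
    (C₁ ≈ ((f , false) ∷ A)) × (C₂ ≈ ((f , true) ∷ B)) × (D ≈ (A ++ B))

Implies : ∀ {n} → LinClause n → LinClause n → Set
Implies {n} C D = (x : Assignment n) → SatClause x C → SatClause x D

-- Res(⊕) derivations as sequences of clauses (stored most recent first)
data Deriv {n} (φ : LinCNF n) : List (LinClause n) → Set where
  []    : Deriv φ []
  axiom : ∀ {Γ C} → C ∈ φ → Deriv φ Γ → Deriv φ (C ∷ Γ)
  res   : ∀ {Γ C₁ C₂ D} → C₁ ∈ Γ → C₂ ∈ Γ → Resolvent C₁ C₂ D →
          Deriv φ Γ → Deriv φ (D ∷ Γ)
  weak  : ∀ {Γ C D} → C ∈ Γ → Implies C D → Deriv φ Γ → Deriv φ (D ∷ Γ)

Refutation : ∀ {n} → LinCNF n → Set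
Refutation {n} φ = Σ (List (LinClause n)) λ Γ → Deriv φ Γ × ([] ∈ Γ)

maxWidth : ∀ {n} → List (LinClause n) → ℕ
maxWidth [] = 0
maxWidth (C ∷ Γ) = width C ⊔ maxWidth Γ

refWidth : ∀ {n} {φ : LinCNF n} → Refutation φ → ℕ
refWidth ρ = maxWidth (proj₁ ρ)

Config : ℕ → Set
Config n = List (LinClause n)

data Step {n} (φ : LinCNF n) : Config n → Config n → Set where
  download : ∀ {S C} → C ∈ φ → Step φ S (C ∷ S)
  erase    : ∀ A C B → Step φ (A ++ (C ∷ B)) (A ++ B)
  inferRes : ∀ {S C₁ C₂ D} → C₁ ∈ S → C₂ ∈ S → Resolvent C₁ C₂ D →
             Step φ S (D ∷ S)
  inferWeak : ∀ {S C D} → C ∈ S → Implies C D → Step φ S (D ∷ S)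

data SpaceDeriv {n} (φ : LinCNF n) : Config n → Set where
  done : ∀ {S} → [] ∈ S → SpaceDeriv φ S
  step : ∀ {S S'} → Step φ S S' → SpaceDeriv φ S' → SpaceDeriv φ S

space : ∀ {n} {φ : LinCNF n} {S} → SpaceDeriv φ S → ℕ
space {S = S} (done _) = length S
space {S = S} (step _ π) = length S ⊔ space π

SpaceRefutation : ∀ {n} → LinCNF n → Set
SpaceRefutation φ = SpaceDeriv φ []

module Submission where

open import Defs
open import Data.Nat using (ℕ; _≤_; _+_)
open import Data.Product using (Σ)

open import Data.Nat using (zero; suc; _<_; z≤n; s≤s)
open import Data.Nat.Properties
  using (≤-refl; ≤-trans; ≤-<-trans; <⇒≤; n≤1+n; m≤n⇒m≤1+n; m≤m+n; m≤n+m;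
         +-comm; +-mono-≤; +-monoˡ-≤; +-monoʳ-≤; suc-injective; m⊔n≤o⇒m≤o; m⊔n≤o⇒n≤o; m≤m⊔n; ⊔-lub;
         module ≤-Reasoning)
open import Data.Bool using (Bool; true; false; not; _xor_; _∧_; if_then_else_)
open import Data.Bool.Properties
  using (not-involutive; not-¬; ¬-not; xor-assoc; xor-same; xor-identityʳ)
  renaming (_≟_ to _≟ᵇ_)
open import Data.Bool.Solver using (module xor-∧-Solver)
open import Data.Vec using ([]; _∷_; lookup; zipWith; updateAt; replicate)
open import Data.Fin using (Fin; zero; suc)
open import Data.List using (List; []; _∷_; _++_; length; map; deduplicate)
open import Data.List.Properties
  using (length-++; length-map; length-removeAt′; length-deduplicate)
open import Data.List.Membership.Propositional using (_∈_; _─_; find; lose)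
open import Data.List.Membership.Propositional.Properties
  using (∈-++⁺ˡ; ∈-++⁺ʳ; ∈-++⁻; ∈-deduplicate⁺; ∈-deduplicate⁻)
open import Data.List.Relation.Binary.Subset.Propositional using (_⊆_)
open import Data.List.Relation.Binary.Subset.Propositional.Properties
  using (⊆-refl; xs⊆xs++ys; xs⊆ys++xs; xs⊆x∷xs; ∈-∷⁺ʳ; Any-resp-⊆)
  renaming (++⁺ to ++⁺-⊆)
open import Data.List.Relation.Unary.All as All using (All; []; _∷_)
open import Data.List.Relation.Unary.All.Properties
  using (++⁺; ++⁻; map⁺; map⁻; All¬⇒¬Any)
open import Data.List.Relation.Unary.Any as Any using (Any; here; there)
open import Data.List.Relation.Unary.Any.Properties using (¬Any[])
open import Data.List.Relation.Unary.Unique.Propositional using (Unique)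
open import Data.List.Relation.Unary.AllPairs using (_∷_)
import Data.List.Relation.Unary.Unique.DecPropositional.Properties as DecUnique
open import Data.Product using (∃; _×_; _,_; proj₁; proj₂)
open import Data.Sum using (_⊎_; inj₁; inj₂; [_,_]′)
open import Data.Empty using (⊥-elim)
open import Relation.Nullary using (¬_; yes; no)
open import Relation.Binary.PropositionalEquality
  using (_≡_; _≢_; refl; sym; trans; cong; cong₂; subst; ≢-sym; module ≡-Reasoning)

-- Read the space refutation backwards.  Call N a hitting clause of a
-- configuration S if N contains the negation of some literal of every clause
-- of S.  Every hitting clause of S with at most |S| literals has a derivation
-- of width space + r + 1, by backward induction: the last configuration
-- contains the empty clause and so has no hitting clause; an erasure is
-- handled by a sub-clause of N hitting the smaller configuration; a download
-- of C is undone by resolving C ∨ N with the clauses ¬ℓ ∨ N, ℓ ∈ C; after a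
-- resolution step N either still hits the resolvent or is a tautology.  After
-- a weakening C ⊨ D, the hit literal of C and the negated literals of D form
-- an inconsistent linear system whose equations e all have derivable clauses
-- e ∨ N, and Gaussian elimination derives N through clauses at most two
-- literals wider than N.  The empty clause hits the initial empty
-- configuration.

module _ {A : Set} where

  ∈-─⁺ : ∀ {x y} {ys : List A} (x∈ys : x ∈ ys) → y ∈ ys → y ≢ x → y ∈ ys ─ x∈ys
  ∈-─⁺ (here refl) (here refl) y≢x = ⊥-elim (y≢x refl)
  ∈-─⁺ (here refl) (there y∈ys) _ = y∈ys
  ∈-─⁺ (there _) (here refl) _ = here refl
  ∈-─⁺ (there x∈ys) (there y∈ys) y≢x = there (∈-─⁺ x∈ys y∈ys y≢x)

  unique-⊆⇒length≤ : {xs ys : List A} → Unique xs → xs ⊆ ys → length xs ≤ length ys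
  unique-⊆⇒length≤ {[]} _ _ = z≤n
  unique-⊆⇒length≤ {x ∷ xs} {ys} (x∉xs ∷ xs!) xs⊆ys = begin
    suc (length xs)              ≤⟨ s≤s (unique-⊆⇒length≤ xs! xs⊆ys─x) ⟩
    suc (length (ys ─ x∈ys))     ≡⟨ sym (length-removeAt′ ys _) ⟩
    length ys                    ∎
    where
    open ≤-Reasoning
    x∈ys : x ∈ ys
    x∈ys = xs⊆ys (here refl)
    xs⊆ys─x : xs ⊆ ys ─ x∈ys
    xs⊆ys─x y∈xs = ∈-─⁺ x∈ys (xs⊆ys (there y∈xs)) (≢-sym (All.lookup x∉xs y∈xs))

private
  variable
    n : ℕ

width≤length : (C : LinClause n) → width C ≤ length C
width≤length = length-deduplicate _≟ℓ_

width-mono : {C D : LinClause n} → C ⊆ D → width C ≤ width D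
width-mono {C = C} C⊆D =
  unique-⊆⇒length≤ (DecUnique.deduplicate-! _≟ℓ_ C)
    (λ ℓ∈C → ∈-deduplicate⁺ _≟ℓ_ (C⊆D (∈-deduplicate⁻ _≟ℓ_ C ℓ∈C)))

width-++ : (C D : LinClause n) → width (C ++ D) ≤ width C + width D
width-++ C D = begin
  width (C ++ D)                 ≤⟨ width-mono C++D⊆ ⟩
  width (dedup C ++ dedup D)     ≤⟨ width≤length (dedup C ++ dedup D) ⟩
  length (dedup C ++ dedup D)    ≡⟨ length-++ (dedup C) ⟩
  width C + width D              ∎
  where
  open ≤-Reasoning
  dedup : LinClause n → LinClause n
  dedup = deduplicate _≟ℓ_
  C++D⊆ : C ++ D ⊆ dedup C ++ dedup D
  C++D⊆ = ++⁺-⊆ {ws = C} {ys = D} (∈-deduplicate⁺ _≟ℓ_) (∈-deduplicate⁺ _≟ℓ_)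

width-∷ : (ℓ : LinLit n) (C : LinClause n) → width (ℓ ∷ C) ≤ suc (width C)
width-∷ ℓ = width-++ (ℓ ∷ [])

_⊕_ : LinForm n → LinForm n → LinForm n
_⊕_ = zipWith _xor_

evalForm-⊕ : (f g : LinForm n) (x : Assignment n) →
             evalForm (f ⊕ g) x ≡ evalForm f x xor evalForm g x
evalForm-⊕ [] [] [] = refl
evalForm-⊕ (a ∷ f) (c ∷ g) (b ∷ x) = begin
  ((a xor c) ∧ b) xor evalForm (f ⊕ g) x                    ≡⟨ cong (((a xor c) ∧ b) xor_) (evalForm-⊕ f g x) ⟩
  ((a xor c) ∧ b) xor (evalForm f x xor evalForm g x)        ≡⟨ distrib a c b (evalForm f x) (evalForm g x) ⟩
  ((a ∧ b) xor evalForm f x) xor ((c ∧ b) xor evalForm g x)  ∎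
  where
  open ≡-Reasoning
  open xor-∧-Solver
  distrib : ∀ a c b u v → ((a xor c) ∧ b) xor (u xor v) ≡ ((a ∧ b) xor u) xor ((c ∧ b) xor v)
  distrib = solve 5 (λ a c b u v → ((a :+ c) :* b) :+ (u :+ v) := ((a :* b) :+ u) :+ ((c :* b) :+ v))
                    refl

flipAt : Fin n → Bool → Assignment n → Assignment n
flipAt j t x = updateAt x j (_xor t)

evalForm-flipAt : (f : LinForm n) (j : Fin n) (t : Bool) (x : Assignment n) →
                  evalForm f (flipAt j t x) ≡ evalForm f x xor (lookup f j ∧ t)
evalForm-flipAt (a ∷ f) zero t (b ∷ x) = distrib a b t (evalForm f x)
  where
  open xor-∧-Solver
  distrib : ∀ a b t u → (a ∧ (b xor t)) xor u ≡ ((a ∧ b) xor u) xor (a ∧ t)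
  distrib = solve 4 (λ a b t u → (a :* (b :+ t)) :+ u := ((a :* b) :+ u) :+ (a :* t)) refl
evalForm-flipAt (a ∷ f) (suc j) t (b ∷ x) =
  trans (cong ((a ∧ b) xor_) (evalForm-flipAt f j t x)) (sym (xor-assoc (a ∧ b) _ _))

pivot⊎null : (f : LinForm n) → (∃ λ j → lookup f j ≡ true) ⊎ (∀ x → evalForm f x ≡ false)
pivot⊎null [] = inj₂ λ { [] → refl }
pivot⊎null (true ∷ f) = inj₁ (zero , refl)
pivot⊎null (false ∷ f) with pivot⊎null f
... | inj₁ (j , fⱼ) = inj₁ (suc j , fⱼ)
... | inj₂ f≡0 = inj₂ λ { (_ ∷ x) → f≡0 x }

neg : LinLit n → LinLit n
neg (f , α) = f , not α

neg-involutive : (ℓ : LinLit n) → neg (neg ℓ) ≡ ℓ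
neg-involutive (f , α) = cong (f ,_) (not-involutive α)

sat⊎sat-neg : (x : Assignment n) (ℓ : LinLit n) → SatLit x ℓ ⊎ SatLit x (neg ℓ)
sat⊎sat-neg x (f , α) with evalForm f x ≟ᵇ α
... | yes fx≡α = inj₁ fx≡α
... | no fx≢α = inj₂ (¬-not fx≢α)

sat⇒¬sat-neg : (x : Assignment n) (ℓ : LinLit n) → SatLit x ℓ → ¬ SatLit x (neg ℓ)
sat⇒¬sat-neg _ _ = not-¬

_⊕ₗ_ : LinLit n → LinLit n → LinLit n
(g , c) ⊕ₗ (f , b) = g ⊕ f , c xor b

sat-⊕ₗ : {x : Assignment n} {e p : LinLit n} → SatLit x e → SatLit x p → SatLit x (e ⊕ₗ p)
sat-⊕ₗ {x = x} {g , _} {f , _} gx≡c fx≡b = trans (evalForm-⊕ g f x) (cong₂ _xor_ gx≡c fx≡b)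

Inconsistent : List (LinLit n) → Set
Inconsistent {n} L = (x : Assignment n) → ¬ All (SatLit x) L

-- Meaningful when the pivot p has j-th coefficient 1.
eliminate : LinLit n → Fin n → LinLit n → LinLit n
eliminate p j (g , c) = if lookup g j then (g , c) ⊕ₗ p else (g , c)

module _ {f : LinForm n} {b : Bool} {j : Fin n} (fⱼ : lookup f j ≡ true) where

  private
    x′ : Assignment n → Assignment n
    x′ x = flipAt j (evalForm f x xor b) x

  sat-pivot : (x : Assignment n) → SatLit (x′ x) (f , b)
  sat-pivot x = begin
    evalForm f (x′ x)                                     ≡⟨ evalForm-flipAt f j _ x ⟩
    evalForm f x xor (lookup f j ∧ (evalForm f x xor b))  ≡⟨ cong (λ a → evalForm f x xor (a ∧ _)) fⱼ ⟩
    evalForm f x xor (evalForm f x xor b)                 ≡⟨ sym (xor-assoc (evalForm f x) _ b) ⟩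
    (evalForm f x xor evalForm f x) xor b                 ≡⟨ cong (_xor b) (xor-same (evalForm f x)) ⟩
    b                                                     ∎
    where open ≡-Reasoning

  sat-eliminate : (x : Assignment n) (e : LinLit n) →
                  SatLit x (eliminate (f , b) j e) → SatLit (x′ x) e
  sat-eliminate x (g , c) sat with lookup g j in gⱼ
  ... | true = begin
    evalForm g (x′ x)                                     ≡⟨ evalForm-flipAt g j _ x ⟩
    evalForm g x xor (lookup g j ∧ (evalForm f x xor b))  ≡⟨ cong (λ a → evalForm g x xor (a ∧ _)) gⱼ ⟩
    evalForm g x xor (evalForm f x xor b)                 ≡⟨ sym (xor-assoc (evalForm g x) _ b) ⟩
    (evalForm g x xor evalForm f x) xor b                 ≡⟨ cong (_xor b) (trans (sym (evalForm-⊕ g f x)) sat) ⟩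
    (c xor b) xor b                                       ≡⟨ xor-assoc c b b ⟩
    c xor (b xor b)                                       ≡⟨ cong (c xor_) (xor-same b) ⟩
    c xor false                                           ≡⟨ xor-identityʳ c ⟩
    c                                                     ∎
    where open ≡-Reasoning
  ... | false = begin
    evalForm g (x′ x)                                     ≡⟨ evalForm-flipAt g j _ x ⟩
    evalForm g x xor (lookup g j ∧ (evalForm f x xor b))  ≡⟨ cong (λ a → evalForm g x xor (a ∧ _)) gⱼ ⟩
    evalForm g x xor false                                ≡⟨ xor-identityʳ (evalForm g x) ⟩
    evalForm g x                                          ≡⟨ sat ⟩
    c                                                     ∎
    where open ≡-Reasoning

  inconsistent-eliminate : {L : List (LinLit n)} →
    Inconsistent ((f , b) ∷ L) → Inconsistent (map (eliminate (f , b) j) L)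
  inconsistent-eliminate L✗ x sats =
    L✗ (x′ x) (sat-pivot x ∷ All.map (λ {e} → sat-eliminate x e) (map⁻ sats))

deriv-++ : {φ : LinCNF n} {Γ Δ : List (LinClause n)} →
           Deriv φ Γ → Deriv φ Δ → Deriv φ (Δ ++ Γ)
deriv-++ dΓ [] = dΓ
deriv-++ dΓ (axiom C∈φ dΔ) = axiom C∈φ (deriv-++ dΓ dΔ)
deriv-++ dΓ (res C₁∈Δ C₂∈Δ R dΔ) = res (∈-++⁺ˡ C₁∈Δ) (∈-++⁺ˡ C₂∈Δ) R (deriv-++ dΓ dΔ)
deriv-++ dΓ (weak C∈Δ C⇒D dΔ) = weak (∈-++⁺ˡ C∈Δ) C⇒D (deriv-++ dΓ dΔ)

⊆×⊇⇒≈ : {C D : LinClause n} → C ⊆ D → D ⊆ C → C ≈ D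
⊆×⊇⇒≈ C⊆D D⊆C _ = C⊆D , D⊆C

≈-refl : {C : LinClause n} → C ≈ C
≈-refl = ⊆×⊇⇒≈ ⊆-refl ⊆-refl

module BoundedWidth (φ : LinCNF n) (w : ℕ) where

  ⊢_ : LinClause n → Set
  ⊢ C = ∃ λ Γ → Deriv φ Γ × C ∈ Γ × All (λ D → width D ≤ w) Γ

  ⊢-axiom : {C : LinClause n} → C ∈ φ → width C ≤ w → ⊢ C
  ⊢-axiom C∈φ C≤w = _ , axiom C∈φ [] , here refl , C≤w ∷ []

  ⊢-weaken : {C D : LinClause n} → ⊢ C → Implies C D → width D ≤ w → ⊢ D
  ⊢-weaken (Γ , dΓ , C∈Γ , Γ≤w) C⇒D D≤w = _ , weak C∈Γ C⇒D dΓ , here refl , D≤w ∷ Γ≤w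

  ⊢-subsume : {C D : LinClause n} → ⊢ C → C ⊆ D → width D ≤ w → ⊢ D
  ⊢-subsume ⊢C C⊆D = ⊢-weaken ⊢C (λ _ → Any-resp-⊆ C⊆D)

  ⊢-resolve : {C₁ C₂ D : LinClause n} →
              ⊢ C₁ → ⊢ C₂ → Resolvent C₁ C₂ D → width D ≤ w → ⊢ D
  ⊢-resolve (Γ , dΓ , C₁∈Γ , Γ≤w) (Δ , dΔ , C₂∈Δ , Δ≤w) R D≤w =
    _ , res (∈-++⁺ʳ Δ C₁∈Γ) (∈-++⁺ˡ C₂∈Δ) R (deriv-++ dΓ dΔ) , here refl , D≤w ∷ ++⁺ Δ≤w Γ≤w

  ⊢-tautology : {C N : LinClause n} {ℓ : LinLit n} →
                ⊢ C → ℓ ∈ N → neg ℓ ∈ N → width N ≤ w → ⊢ N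
  ⊢-tautology {ℓ = ℓ} ⊢C ℓ∈N ¬ℓ∈N =
    ⊢-weaken ⊢C λ x _ → [ lose ℓ∈N , lose ¬ℓ∈N ]′ (sat⊎sat-neg x ℓ)

  ⊢-cut : {K M : LinClause n} {ℓ : LinLit n} →
          ⊢ (ℓ ∷ K) → ⊢ (neg ℓ ∷ M) → M ⊆ K → width K ≤ w → ⊢ K
  ⊢-cut {K} {M} {f , false} ⊢ℓK ⊢¬ℓM M⊆K =
    ⊢-resolve ⊢ℓK ⊢¬ℓM (f , K , M , ≈-refl , ≈-refl , ⊆×⊇⇒≈ (xs⊆xs++ys K M) K++M⊆K)
    where
    K++M⊆K : K ++ M ⊆ K
    K++M⊆K ℓ∈K++M = [ (λ ℓ∈K → ℓ∈K) , M⊆K ]′ (∈-++⁻ K ℓ∈K++M)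
  ⊢-cut {K} {M} {f , true} ⊢ℓK ⊢¬ℓM M⊆K =
    ⊢-resolve ⊢¬ℓM ⊢ℓK (f , M , K , ≈-refl , ≈-refl , ⊆×⊇⇒≈ (xs⊆ys++xs K M) M++K⊆K)
    where
    M++K⊆K : M ++ K ⊆ K
    M++K⊆K ℓ∈M++K = [ M⊆K , (λ ℓ∈K → ℓ∈K) ]′ (∈-++⁻ M ℓ∈M++K)

  ⊢-cut-all : {N : LinClause n} (K : LinClause n) → (∀ {ℓ} → ℓ ∈ K → ⊢ (neg ℓ ∷ N)) →
              width (K ++ N) ≤ w → ⊢ (K ++ N) → ⊢ N
  ⊢-cut-all [] _ _ ⊢N = ⊢N
  ⊢-cut-all {N} (ℓ ∷ K) ⊢¬K ℓKN≤w ⊢ℓKN =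
    ⊢-cut-all K (λ ℓ∈K → ⊢¬K (there ℓ∈K)) KN≤w
      (⊢-cut ⊢ℓKN (⊢¬K (here refl)) (xs⊆ys++xs N K) KN≤w)
    where
    KN≤w : width (K ++ N) ≤ w
    KN≤w = ≤-trans (width-mono (xs⊆x∷xs (K ++ N) ℓ)) ℓKN≤w

  module _ {N : LinClause n} (2+N≤w : 2 + width N ≤ w) where

    private
      ∷∷N≤w : (a b : LinLit n) → width (a ∷ b ∷ N) ≤ w
      ∷∷N≤w a b = ≤-trans (width-∷ a (b ∷ N)) (≤-trans (s≤s (width-∷ b N)) 2+N≤w)

      ∷N≤w : (e : LinLit n) → width (e ∷ N) ≤ w
      ∷N≤w e = ≤-trans (width-∷ e N) (≤-trans (n≤1+n _) 2+N≤w)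

      N≤w : width N ≤ w
      N≤w = ≤-trans (m≤n+m (width N) 2) 2+N≤w

    ⊢-⊕ₗ : {e p : LinLit n} → ⊢ (e ∷ N) → ⊢ (p ∷ N) → ⊢ (e ⊕ₗ p ∷ N)
    ⊢-⊕ₗ {e} {p} ⊢eN ⊢pN = ⊢-cut ⊢¬pe⊕pN ⊢pN′ (xs⊆x∷xs N (e ⊕ₗ p)) (∷N≤w (e ⊕ₗ p))
      where
      ⊢pN′ : ⊢ (neg (neg p) ∷ N)
      ⊢pN′ = subst (λ q → ⊢ (q ∷ N)) (sym (neg-involutive p)) ⊢pN
      e⇒¬pe⊕p : Implies (e ∷ N) (neg p ∷ e ⊕ₗ p ∷ N)
      e⇒¬pe⊕p x (here sat-e) =
        [ (λ sat-p → there (here (sat-⊕ₗ {e = e} {p} sat-e sat-p))) , here ]′ (sat⊎sat-neg x p)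
      e⇒¬pe⊕p x (there sat-N) = there (there sat-N)
      ⊢¬pe⊕pN : ⊢ (neg p ∷ e ⊕ₗ p ∷ N)
      ⊢¬pe⊕pN = ⊢-weaken ⊢eN e⇒¬pe⊕p (∷∷N≤w (neg p) (e ⊕ₗ p))

    ⊢-eliminate : {e p : LinLit n} (j : Fin n) →
                  ⊢ (e ∷ N) → ⊢ (p ∷ N) → ⊢ (eliminate p j e ∷ N)
    ⊢-eliminate {g , c} j ⊢eN ⊢pN with lookup g j
    ... | true = ⊢-⊕ₗ ⊢eN ⊢pN
    ... | false = ⊢eN

    ⊢-inconsistent : (k : ℕ) (L : List (LinLit n)) → length L ≡ k →
                     All (λ e → ⊢ (e ∷ N)) L → Inconsistent L → ⊢ N
    ⊢-inconsistent _ [] _ _ L✗ = ⊥-elim (L✗ (replicate _ false) [])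
    ⊢-inconsistent zero (_ ∷ _) () _ _
    ⊢-inconsistent (suc k) ((f , b) ∷ L) |L|≡ (⊢pN ∷ ⊢LN) L✗ with pivot⊎null f
    ... | inj₁ (j , fⱼ) =
      ⊢-inconsistent k (map (eliminate (f , b) j) L)
        (trans (length-map _ L) (suc-injective |L|≡))
        (map⁺ (All.map (λ ⊢eN → ⊢-eliminate j ⊢eN ⊢pN) ⊢LN))
        (inconsistent-eliminate fⱼ L✗)
    ... | inj₂ f≡0 with b
    ...   | true =
      ⊢-weaken ⊢pN (λ { x (here fx≡1) → ⊥-elim (not-¬ (f≡0 x) fx≡1) ; _ (there sat-N) → sat-N }) N≤w
    ...   | false =
      ⊢-inconsistent k L (suc-injective |L|≡) ⊢LN (λ x sats → L✗ x (f≡0 x ∷ sats))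

maxWidth≤ : {Γ : List (LinClause n)} {w : ℕ} → All (λ C → width C ≤ w) Γ → maxWidth Γ ≤ w
maxWidth≤ [] = z≤n
maxWidth≤ (C≤w ∷ Γ≤w) = ⊔-lub C≤w (maxWidth≤ Γ≤w)

length≤space : {φ : LinCNF n} {S : Config n} (π : SpaceDeriv φ S) → length S ≤ space π
length≤space (done _) = ≤-refl
length≤space (step _ π) = m≤m⊔n _ (space π)

unsatisfiable⇒nonempty : {φ : LinCNF n} → Unsatisfiable φ → ∃ λ C → C ∈ φ
unsatisfiable⇒nonempty {φ = []} unsat = ⊥-elim (unsat (replicate _ false) [])
unsatisfiable⇒nonempty {φ = C ∷ _} _ = C , here refl

Hits : LinClause n → Config n → Set
Hits N S = All (Any (λ ℓ → neg ℓ ∈ N)) S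

hits-mono : {N M : LinClause n} {S : Config n} → N ⊆ M → Hits N S → Hits M S
hits-mono N⊆M = All.map (Any.map N⊆M)

hits-─ : {N : LinClause n} (A : Config n) {C : LinClause n} {B : Config n} →
         Hits N (A ++ C ∷ B) → Hits N (A ++ B)
hits-─ A hits with ++⁻ A hits
... | hitsA , _ ∷ hitsB = ++⁺ hitsA hitsB

hits-shrink : {N : LinClause n} {S : Config n} →
              Hits N S → ∃ λ M → M ⊆ N × Hits M S × length M ≤ length S
hits-shrink [] = [] , (λ ()) , [] , z≤n
hits-shrink (hitC ∷ hitS) with find hitC | hits-shrink hitS
... | ℓ , ℓ∈C , ¬ℓ∈N | M , M⊆N , hitsM , |M|≤|S| =
  neg ℓ ∷ M , ∈-∷⁺ʳ ¬ℓ∈N M⊆N ,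
  lose ℓ∈C (here refl) ∷ hits-mono (xs⊆x∷xs M (neg ℓ)) hitsM , s≤s |M|≤|S|

module SpaceToWidth {φ : LinCNF n} {r : ℕ} (φ≤r : IsLinearRCNF r φ)
                    {C₀ : LinClause n} (C₀∈φ : C₀ ∈ φ) (s : ℕ) where

  open BoundedWidth φ (s + r + 1)

  HittingDerivable : Config n → Set
  HittingDerivable S = ∀ {N} → Hits N S → length N ≤ length S → ⊢ N

  private
    s+r≤w : s + r ≤ s + r + 1
    s+r≤w = m≤m+n (s + r) 1

    ⊢axiom : {C : LinClause n} → C ∈ φ → ⊢ C
    ⊢axiom C∈φ = ⊢-axiom C∈φ (≤-trans (All.lookup φ≤r C∈φ) (≤-trans (m≤n+m r s) s+r≤w))

    short⇒narrow : (N : LinClause n) → length N ≤ s → width N ≤ s + r + 1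
    short⇒narrow N N≤s = ≤-trans (width≤length N) (≤-trans N≤s (≤-trans (m≤m+n s r) s+r≤w))

    shorter⇒narrower : (N : LinClause n) → length N < s → 2 + width N ≤ s + r + 1
    shorter⇒narrower N N<s = begin
      2 + width N  ≤⟨ s≤s (≤-trans (s≤s (width≤length N)) N<s) ⟩
      1 + s        ≡⟨ +-comm 1 s ⟩
      s + 1        ≤⟨ +-monoˡ-≤ 1 (m≤m+n s r) ⟩
      s + r + 1    ∎
      where open ≤-Reasoning

  hittingDerivable-final : {S : Config n} → [] ∈ S → HittingDerivable S
  hittingDerivable-final []∈S hits _ = ⊥-elim (¬Any[] (All.lookup hits []∈S))

  hittingDerivable-download : {S : Config n} {C : LinClause n} → length S < s → C ∈ φ →
                              HittingDerivable (C ∷ S) → HittingDerivable S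
  hittingDerivable-download {S} {C} S<s C∈φ ih {N} hits N≤S =
    ⊢-cut-all C ⊢¬CN CN≤w (⊢-subsume (⊢axiom C∈φ) (xs⊆xs++ys C N) CN≤w)
    where
    ⊢¬CN : ∀ {ℓ} → ℓ ∈ C → ⊢ (neg ℓ ∷ N)
    ⊢¬CN ℓ∈C = ih (lose ℓ∈C (here refl) ∷ hits-mono (xs⊆x∷xs N _) hits) (s≤s N≤S)
    CN≤w : width (C ++ N) ≤ s + r + 1
    CN≤w = begin
      width (C ++ N)     ≤⟨ width-++ C N ⟩
      width C + width N  ≤⟨ +-mono-≤ (All.lookup φ≤r C∈φ) (≤-trans (width≤length N) N≤S) ⟩
      r + length S       ≤⟨ +-monoʳ-≤ r (<⇒≤ S<s) ⟩
      r + s              ≡⟨ +-comm r s ⟩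
      s + r              ≤⟨ s+r≤w ⟩
      s + r + 1          ∎
      where open ≤-Reasoning

  hittingDerivable-erase : (A : Config n) {C : LinClause n} {B : Config n} →
                           length (A ++ C ∷ B) ≤ s →
                           HittingDerivable (A ++ B) → HittingDerivable (A ++ C ∷ B)
  hittingDerivable-erase A S≤s ih {N} hits N≤S with hits-shrink (hits-─ A hits)
  ... | M , M⊆N , hitsM , M≤S′ =
    ⊢-subsume (ih hitsM M≤S′) M⊆N (short⇒narrow N (≤-trans N≤S S≤s))

  hittingDerivable-resolve : {S : Config n} {C₁ C₂ D : LinClause n} →
                             length S ≤ s → C₁ ∈ S → C₂ ∈ S → Resolvent C₁ C₂ D →
                             HittingDerivable (D ∷ S) → HittingDerivable S
  hittingDerivable-resolve S≤s C₁∈S C₂∈S (f , A , B , C₁≈ , C₂≈ , D≈) ih {N} hits N≤S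
    with find (All.lookup hits C₁∈S) | find (All.lookup hits C₂∈S)
  ... | ℓ₁ , ℓ₁∈C₁ , ¬ℓ₁∈N | ℓ₂ , ℓ₂∈C₂ , ¬ℓ₂∈N
    with proj₁ (C₁≈ ℓ₁) ℓ₁∈C₁ | proj₁ (C₂≈ ℓ₂) ℓ₂∈C₂
  ... | there ℓ₁∈A | _ =
    ih (lose (proj₂ (D≈ ℓ₁) (∈-++⁺ˡ ℓ₁∈A)) ¬ℓ₁∈N ∷ hits) (m≤n⇒m≤1+n N≤S)
  ... | here refl | there ℓ₂∈B =
    ih (lose (proj₂ (D≈ ℓ₂) (∈-++⁺ʳ A ℓ₂∈B)) ¬ℓ₂∈N ∷ hits) (m≤n⇒m≤1+n N≤S)
  ... | here refl | here refl =
    ⊢-tautology (⊢axiom C₀∈φ) ¬ℓ₂∈N ¬ℓ₁∈N (short⇒narrow N (≤-trans N≤S S≤s))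

  hittingDerivable-weaken : {S : Config n} {C D : LinClause n} →
                            length S < s → C ∈ S → Implies C D →
                            HittingDerivable (D ∷ S) → HittingDerivable S
  hittingDerivable-weaken {D = D} S<s C∈S C⇒D ih {N} hits N≤S with find (All.lookup hits C∈S)
  ... | ℓ , ℓ∈C , ¬ℓ∈N =
    ⊢-inconsistent 2+N≤w _ (ℓ ∷ map neg D) refl (⊢ℓN ∷ map⁺ (All.tabulate ⊢¬DN)) inconsistent
    where
    2+N≤w : 2 + width N ≤ s + r + 1
    2+N≤w = shorter⇒narrower N (≤-<-trans N≤S S<s)
    ⊢ℓN : ⊢ (ℓ ∷ N)
    ⊢ℓN = ⊢-tautology (⊢axiom C₀∈φ) (here refl) (there ¬ℓ∈N)
            (≤-trans (width-∷ ℓ N) (≤-trans (n≤1+n _) 2+N≤w))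
    ⊢¬DN : ∀ {ℓ′} → ℓ′ ∈ D → ⊢ (neg ℓ′ ∷ N)
    ⊢¬DN ℓ′∈D = ih (lose ℓ′∈D (here refl) ∷ hits-mono (xs⊆x∷xs N _) hits) (s≤s N≤S)
    inconsistent : Inconsistent (ℓ ∷ map neg D)
    inconsistent x (sat-ℓ ∷ sat-¬D) =
      All¬⇒¬Any (All.map (λ {ℓ′} sat-¬ℓ′ sat-ℓ′ → sat⇒¬sat-neg x ℓ′ sat-ℓ′ sat-¬ℓ′) (map⁻ sat-¬D))
                (C⇒D x (lose ℓ∈C sat-ℓ))

  hittingDerivable-step : {S S′ : Config n} → length S ≤ s → length S′ ≤ s → Step φ S S′ →
                          HittingDerivable S′ → HittingDerivable S
  hittingDerivable-step _ S′≤s (download C∈φ) = hittingDerivable-download S′≤s C∈φ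
  hittingDerivable-step S≤s _ (erase A C B) = hittingDerivable-erase A S≤s
  hittingDerivable-step S≤s _ (inferRes C₁∈S C₂∈S R) =
    hittingDerivable-resolve S≤s C₁∈S C₂∈S R
  hittingDerivable-step _ S′≤s (inferWeak C∈S C⇒D) = hittingDerivable-weaken S′≤s C∈S C⇒D

  hittingDerivable : {S : Config n} (π : SpaceDeriv φ S) → space π ≤ s → HittingDerivable S
  hittingDerivable (done []∈S) _ = hittingDerivable-final []∈S
  hittingDerivable {S} (step S→S′ π) space≤s =
    hittingDerivable-step (m⊔n≤o⇒m≤o (length S) _ space≤s) (≤-trans (length≤space π) π≤s)
      S→S′ (hittingDerivable π π≤s)
    where
    π≤s : space π ≤ s
    π≤s = m⊔n≤o⇒n≤o (length S) (space π) space≤s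

  ⊢[] : (π : SpaceRefutation φ) → space π ≤ s → ⊢ []
  ⊢[] π space≤s = hittingDerivable π space≤s [] z≤n

theorem4p7 : ∀ {n : ℕ} (r : ℕ) (φ : LinCNF n) → IsLinearRCNF r φ → Unsatisfiable φ →
    (π : SpaceRefutation φ) → Σ (Refutation φ) (λ ρ → refWidth ρ ≤ space π + r + 1)
theorem4p7 r φ φ≤r unsat π =
  let C₀ , C₀∈φ = unsatisfiable⇒nonempty unsat
      Γ , dΓ , []∈Γ , Γ≤w = SpaceToWidth.⊢[] φ≤r C₀∈φ (space π) π ≤-refl
  in (Γ , dΓ , []∈Γ) , maxWidth≤ Γ≤w
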